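{- Let $\mathfrak F=\langle U,B\rangle$ be a betweenness frame and let $\uparrow\{x\},\uparrow\{y\},\uparrow\{z\}$ be principal ultrafilters of the power set algebra $2^U$ ($x,y,z\in U$). If $Q_{\langle B\rangle}(\uparrow\{x\},\uparrow\{y\},\uparrow\{z\})$ then $S_{[\![B]\!]}(\uparrow\{x\},\uparrow\{y\},\uparrow\{z\})$. In particular, if $U$ is finite, then $Q_{\langle B\rangle}=S_{[\![B]\!]}$.
   Context: A betweenness frame is $\langle U,B\rangle$, $U\ne\emptyset$, $B\subseteq U^3$, with for all $a,b,c$: $B(a,a,a)$; $B(a,b,c)\to B(c,b,a)$; $B(a,b,c)\to B(a,a,b)$; $B(a,b,c)\wedge B(a,c,b)\to b=c$. $\uparrow\{x\}=\{X\subseteq U\mid x\in X\}$. $\langle B\rangle(X,Y)=\{u\mid\exists x\in X\,\exists y\in Y\ B(x,u,y)\}$, $[\![B]\!](X,Y)=\{u\mid X\times\{u\}\times Y\subseteq B\}$. For ultrafilters $u_1,u_2,u_3$ of $2^U$: $Q_{\langle B\rangle}(u_1,u_2,u_3)$ iff $\langle B\rangle[u_1\times u_3]\subseteq u_2$; $S_{[\![B]\!]}(u_1,u_2,u_3)$ iff $[\![B]\!][u_1\times u_3]\cap u_2\ne\emptyset$. -}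

module Defs where

open import Level using (0ℓ)
open import Data.Nat using (ℕ)
open import Data.Fin using (Fin)
open import Data.Unit using (⊤)
open import Data.Product using (Σ; ∃; ∃-syntax; _×_; _,_)
open import Data.Sum using (_⊎_)
open import Data.Empty using (⊥)
open import Relation.Nullary using (¬_)
open import Relation.Binary.PropositionalEquality using (_≡_)
open import Relation.Unary using (Pred; _∈_; _⊆_; _∩_; ∁)
open import Function.Bundles using (_⇔_; _↔_)

Subset : Set → Set₁
Subset U = Pred U 0ℓ

Rel3 : Set → Set₁
Rel3 U = U → U → U → Set

record IsBetweennessFrame (U : Set) (B : Rel3 U) : Set where
  field
    nonempty : U
    refl3    : ∀ a → B a a a
    symm     : ∀ {a b c} → B a b c → B c b a
    left     : ∀ {a b c} → B a b c → B a a b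
    antisym  : ∀ {a b c} → B a b c → B a c b → b ≡ c

Family : Set → Set₁
Family U = Pred (Subset U) 0ℓ

record IsUltrafilter {U : Set} (F : Family U) : Set₁ where
  field
    top      : (λ (_ : U) → ⊤) ∈ F
    proper   : ¬ ((λ (_ : U) → ⊥) ∈ F)
    upward   : ∀ {X Y : Subset U} → X ⊆ Y → X ∈ F → Y ∈ F
    meet     : ∀ {X Y : Subset U} → X ∈ F → Y ∈ F → (X ∩ Y) ∈ F
    ultra    : ∀ (X : Subset U) → X ∈ F ⊎ ∁ X ∈ F

↑ : {U : Set} → U → Family U
↑ x X = x ∈ X

⟨_⟩ : {U : Set} → Rel3 U → Subset U → Subset U → Subset U
⟨ B ⟩ X Y u = ∃[ x ] ∃[ y ] (x ∈ X × y ∈ Y × B x u y)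

⟦_⟧ : {U : Set} → Rel3 U → Subset U → Subset U → Subset U
⟦ B ⟧ X Y u = ∀ x y → x ∈ X → y ∈ Y → B x u y

-- Q_⟨B⟩(u1,u2,u3) iff ⟨B⟩[u1 × u3] ⊆ u2
Q⟨_⟩ : {U : Set} → Rel3 U → Family U → Family U → Family U → Set₁
Q⟨_⟩ {U} B u₁ u₂ u₃ = ∀ (X Y : Subset U) → X ∈ u₁ → Y ∈ u₃ → ⟨ B ⟩ X Y ∈ u₂

-- S_[[B]](u1,u2,u3) iff [[B]][u1 × u3] ∩ u2 ≠ ∅
-- (nonemptiness rendered as the existence of a witness)
S⟦_⟧ : {U : Set} → Rel3 U → Family U → Family U → Family U → Set₁
S⟦_⟧ {U} B u₁ u₂ u₃ = ∃[ X ] ∃[ Y ] (X ∈ u₁ × Y ∈ u₃ × ⟦ B ⟧ X Y ∈ u₂)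

Finite : Set → Set
Finite U = ∃[ n ] (U ↔ Fin n)

{-# OPTIONS --safe #-}
-- A set in an ultrafilter cannot be empty, so if a singleton {a} lies in u₁ and
-- {c} in u₃, then Q yields ⟨B⟩({a},{c}) ∈ u₂, and ⟨B⟩({a},{c}) ⊆ ⟦B⟧({a},{c});
-- the principal case is the instance u₁ = ↑ x, u₃ = ↑ z. Conversely S gives
-- X₀ ∈ u₁, Y₀ ∈ u₃ with ⟦B⟧(X₀,Y₀) ∈ u₂, and for X ∈ u₁, Y ∈ u₃ the sets
-- X ∩ X₀ and Y ∩ Y₀ are nonempty, whence ⟦B⟧(X₀,Y₀) ⊆ ⟨B⟩(X,Y).
-- On a finite U every ultrafilter is principal, so the two arguments meet.
module Submission where

open import Defs
open import Data.Empty using (⊥-elim)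
open import Data.Fin using (Fin; toℕ; fromℕ<)
open import Data.Fin.Properties using (toℕ-fromℕ<; toℕ-injective; toℕ<n)
open import Data.Nat using (ℕ; zero; suc; _≤_; z≤n; s≤s)
open import Data.Nat.Properties using (≤-trans; ≤-refl; n≤1+n; ≤∧≢⇒<; <-irrefl)
open import Data.Product using (_×_; _,_; ∃-syntax)
open import Data.Sum using (_⊎_; inj₁; inj₂)
open import Function using (const)
open import Function.Bundles using (_⇔_; mk⇔; _↔_; Inverse)
open import Relation.Nullary using (¬_)
open import Relation.Unary using (_∈_; _⊆_; _∩_; ∁; ｛_｝)
open import Relation.Binary.PropositionalEquality using (_≡_; refl; trans; cong)

UpwardClosed : {U : Set} → Family U → Set₁
UpwardClosed {U} u = ∀ {X Y : Subset U} → X ⊆ Y → X ∈ u → Y ∈ u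

↑-upwardClosed : {U : Set} (x : U) → UpwardClosed (↑ x)
↑-upwardClosed x X⊆Y x∈X = X⊆Y x∈X

module _ {U : Set} {u : Family U} (uf : IsUltrafilter u) where
  open IsUltrafilter uf

  const∈⇒¬¬ : (P : Set) → const P ∈ u → ¬ ¬ P
  const∈⇒¬¬ P P∈u ¬p = proper (upward ¬p P∈u)

  ¬¬⇒const∈ : (P : Set) → ¬ ¬ P → const P ∈ u
  ¬¬⇒const∈ P ¬¬p with ultra (const P)
  ... | inj₁ P∈u  = P∈u
  ... | inj₂ ¬P∈u = ⊥-elim (¬¬p (λ p → proper (upward (λ ¬p → ¬p p) ¬P∈u)))

-- Constructively X ∈ u only gives ¬ ¬ ∃ X, so nonemptiness is passed between
-- ultrafilters as membership of the constant set instead of as a witness.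
const∈-transfer : {U : Set} {u u' : Family U} → IsUltrafilter u → IsUltrafilter u' →
  (P : Set) → const P ∈ u → const P ∈ u'
const∈-transfer uf uf' P P∈u = ¬¬⇒const∈ uf' P (const∈⇒¬¬ uf P P∈u)

meet-inhabited∈ : {U : Set} {u u' : Family U} → IsUltrafilter u → IsUltrafilter u' →
  {X Y : Subset U} → X ∈ u → Y ∈ u → const (∃[ x ] (x ∈ X × x ∈ Y)) ∈ u'
meet-inhabited∈ uf uf' X∈u Y∈u =
  const∈-transfer uf uf' _ (IsUltrafilter.upward uf (λ {x} x∈X∩Y → x , x∈X∩Y) (IsUltrafilter.meet uf X∈u Y∈u))

module _ {U : Set} {n : ℕ} (U↔Fin : U ↔ Fin n) {u : Family U} (uf : IsUltrafilter u) where
  open Inverse U↔Fin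
  open IsUltrafilter uf

  indexAtLeast : ℕ → Subset U
  indexAtLeast k v = k ≤ toℕ (to v)

  indexAtLeast-step : ∀ {k} (k<n : suc k ≤ n) →
    indexAtLeast k ∩ ∁ ｛ from (fromℕ< k<n) ｝ ⊆ indexAtLeast (suc k)
  indexAtLeast-step {k} k<n {v} (k≤v , v≢) = ≤∧≢⇒< k≤v k≢v
    where
    k≢v : ¬ k ≡ toℕ (to v)
    k≢v k≡v = v≢ (trans (cong from (toℕ-injective (trans (toℕ-fromℕ< k<n) k≡v)))
                        (strictlyInverseʳ v))

  principal-or-indexAtLeast∈ : ∀ k → k ≤ n → (∃[ a ] ｛ a ｝ ∈ u) ⊎ indexAtLeast k ∈ u
  principal-or-indexAtLeast∈ zero    _   = inj₂ (upward (λ _ → z≤n) top)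
  principal-or-indexAtLeast∈ (suc k) k<n
    with principal-or-indexAtLeast∈ k (≤-trans (n≤1+n k) k<n)
  ... | inj₁ principal = inj₁ principal
  ... | inj₂ atLeast-k∈u with ultra ｛ from (fromℕ< k<n) ｝
  ...   | inj₁ a∈u  = inj₁ (_ , a∈u)
  ...   | inj₂ ∁a∈u = inj₂ (upward (indexAtLeast-step k<n) (meet atLeast-k∈u ∁a∈u))

  finite⇒principal : ∃[ a ] ｛ a ｝ ∈ u
  finite⇒principal with principal-or-indexAtLeast∈ n ≤-refl
  ... | inj₁ principal = principal
  ... | inj₂ atLeast-n∈u =
    ⊥-elim (proper (upward (λ {v} n≤v → <-irrefl refl (≤-trans (s≤s n≤v) (toℕ<n (to v)))) atLeast-n∈u))

⟨⟩-singletons⊆⟦⟧ : {U : Set} (B : Rel3 U) (a c : U) → ⟨ B ⟩ ｛ a ｝ ｛ c ｝ ⊆ ⟦ B ⟧ ｛ a ｝ ｛ c ｝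
⟨⟩-singletons⊆⟦⟧ B a c (_ , _ , refl , refl , Babc) _ _ refl refl = Babc

Q⇒S-principal : {U : Set} (B : Rel3 U) {u₁ u₂ u₃ : Family U} → UpwardClosed u₂ →
  ∀ {a c} → ｛ a ｝ ∈ u₁ → ｛ c ｝ ∈ u₃ → Q⟨ B ⟩ u₁ u₂ u₃ → S⟦ B ⟧ u₁ u₂ u₃
Q⇒S-principal B up₂ {a} {c} a∈u₁ c∈u₃ q =
  ｛ a ｝ , ｛ c ｝ , a∈u₁ , c∈u₃ , up₂ (⟨⟩-singletons⊆⟦⟧ B a c) (q ｛ a ｝ ｛ c ｝ a∈u₁ c∈u₃)

S⇒Q : {U : Set} (B : Rel3 U) {u₁ u₂ u₃ : Family U} →
  IsUltrafilter u₁ → IsUltrafilter u₂ → IsUltrafilter u₃ → S⟦ B ⟧ u₁ u₂ u₃ → Q⟨ B ⟩ u₁ u₂ u₃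
S⇒Q B uf₁ uf₂ uf₃ (X₀ , Y₀ , X₀∈u₁ , Y₀∈u₃ , ⟦⟧∈u₂) X Y X∈u₁ Y∈u₃ =
  upward ⟦⟧∩inhabited⊆⟨⟩ (meet ⟦⟧∈u₂ (meet (meet-inhabited∈ uf₁ uf₂ X₀∈u₁ X∈u₁)
                                           (meet-inhabited∈ uf₃ uf₂ Y₀∈u₃ Y∈u₃)))
  where
  open IsUltrafilter uf₂
  ⟦⟧∩inhabited⊆⟨⟩ : ⟦ B ⟧ X₀ Y₀ ∩ (const (∃[ x ] (x ∈ X₀ × x ∈ X)) ∩ const (∃[ y ] (y ∈ Y₀ × y ∈ Y)))
                   ⊆ ⟨ B ⟩ X Y
  ⟦⟧∩inhabited⊆⟨⟩ (between , (x , x∈X₀ , x∈X) , (y , y∈Y₀ , y∈Y)) =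
    x , y , x∈X , y∈Y , between x y x∈X₀ y∈Y₀

proposition8p5 : (U : Set) (B : Rel3 U) → IsBetweennessFrame U B →
    (∀ (x y z : U) → Q⟨ B ⟩ (↑ x) (↑ y) (↑ z) → S⟦ B ⟧ (↑ x) (↑ y) (↑ z))
    × (Finite U → ∀ (u₁ u₂ u₃ : Family U) → IsUltrafilter u₁ → IsUltrafilter u₂ → IsUltrafilter u₃ →
        Q⟨ B ⟩ u₁ u₂ u₃ ⇔ S⟦ B ⟧ u₁ u₂ u₃)
proposition8p5 U B _ = principalCase , finiteCase
  where
  principalCase : ∀ (x y z : U) → Q⟨ B ⟩ (↑ x) (↑ y) (↑ z) → S⟦ B ⟧ (↑ x) (↑ y) (↑ z)
  principalCase x y z = Q⇒S-principal B (↑-upwardClosed y) refl refl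

  finiteCase : Finite U → ∀ (u₁ u₂ u₃ : Family U) → IsUltrafilter u₁ → IsUltrafilter u₂ →
    IsUltrafilter u₃ → Q⟨ B ⟩ u₁ u₂ u₃ ⇔ S⟦ B ⟧ u₁ u₂ u₃
  finiteCase (_ , U↔Fin) u₁ u₂ u₃ uf₁ uf₂ uf₃ with finite⇒principal U↔Fin uf₁ | finite⇒principal U↔Fin uf₃
  ... | _ , a∈u₁ | _ , c∈u₃ =
    mk⇔ (Q⇒S-principal B (IsUltrafilter.upward uf₂) a∈u₁ c∈u₃) (S⇒Q B uf₁ uf₂ uf₃)
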